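{- For any integer $k>0$ there is a set $J$ with $|J|=(k^2+k+1)^{k+1}$ and a function $g\colon J^k\to J$ such that, for any tuple $\bar t\in J^k$ consisting of elements $t_1,\dots,t_k$ in some order: (i) $g(\bar t)$ does not occur in $\bar t$; (ii) if $\bar t'\in J^k$ consists of the elements $t_2,\dots,t_k,g(\bar t)$ in some order, then $g(\bar t')$ does not occur in $\bar t$. -}

module Defs where

open import Data.Nat using (ℕ; _+_; _*_; _^_; suc)

size : ℕ → ℕ
size k = (k * k + k + 1) ^ (k + 1)

-- Take J = Fin m ^ (k+1) with m = k² + k + 1, and read an element x
-- of J as a label (its first digit) followed by k pointers. Given a tuple t,
-- the k tuple elements together use at most k(k+1) < m digits, so some digit c
-- occurs in none of them; set g(t) = (c; labels of t). Then g(t) ∉ t because no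
-- element of t has label c. If t' contains g(t), then the labels of t are among
-- the digits of t', which the fresh label of g(t') avoids; hence g(t') ∉ t.
module Submission where

open import Defs
open import Data.Nat using (ℕ; _<_; suc; _*_; _+_; _^_; z<s)
open import Data.Nat.Properties using (*-suc; +-comm; m<m+n)
open import Data.Fin using (Fin; combine; remQuot; _≟_)
open import Data.Fin.Properties using (remQuot-combine; pigeonhole; ¬∀⟶∃¬; <⇒≢)
open import Data.Vec using (Vec; []; _∷_; toList; head; map; concat; lookup)
open import Data.Vec.Membership.Propositional using (_∈_)
open import Data.Vec.Membership.Propositional.Properties using (∈-map⁺; ∈-toList⁻)
import Data.Vec.Membership.DecPropositional as DecMembership
import Data.Vec.Relation.Unary.Any as Any
open import Data.Vec.Relation.Unary.Any.Properties using (lookup-index; concat⁺; map⁺)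
open import Data.List using (List; _∷_; _++_; [_])
open import Data.List.Membership.Propositional using (_∉_)
open import Data.List.Membership.Propositional.Properties using (∈-++⁺ʳ)
open import Data.List.Relation.Unary.Any using (here)
open import Data.List.Relation.Binary.Permutation.Propositional using (_↭_; ↭-sym)
open import Data.List.Relation.Binary.Permutation.Propositional.Properties using (∈-resp-↭)
open import Data.Product using (Σ; _×_; _,_; proj₁; proj₂; ∃)
open import Function using (_∘_)
open import Relation.Binary.PropositionalEquality using (_≡_; refl; sym; trans; cong; subst)
open import Relation.Nullary using (¬_)

n<m⇒∃∉ : ∀ {m n} → n < m → (xs : Vec (Fin m) n) → ∃ λ c → ¬ c ∈ xs
n<m⇒∃∉ {m} n<m xs = ¬∀⟶∃¬ m (_∈ xs) (λ c → DecMembership._∈?_ _≟_ c xs) ¬covers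
  where
  ¬covers : ¬ (∀ c → c ∈ xs)
  ¬covers cover with i , j , i<j , sameIndex ← pigeonhole n<m (Any.index ∘ cover)
    = <⇒≢ i<j (trans (lookup-index (cover i))
                (trans (cong (lookup xs) sameIndex) (sym (lookup-index (cover j)))))

fromDigits : ∀ {m n} → Vec (Fin m) n → Fin (m ^ n)
fromDigits []       = Fin.zero
fromDigits (d ∷ ds) = combine d (fromDigits ds)

toDigits : ∀ {m} n → Fin (m ^ n) → Vec (Fin m) n
toDigits      0       _ = []
toDigits {m} (suc n) x = consDigits (remQuot {m} (m ^ n) x)
  where
  consDigits : Fin m × Fin (m ^ n) → Vec (Fin m) (suc n)
  consDigits (d , x′) = d ∷ toDigits n x′

toDigits-fromDigits : ∀ {m n} (ds : Vec (Fin m) n) → toDigits n (fromDigits ds) ≡ ds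
toDigits-fromDigits                []       = refl
toDigits-fromDigits {m} {suc n} (d ∷ ds) = trans
  (cong (λ (d′ , x) → d′ ∷ toDigits n x) (remQuot-combine {m} {m ^ n} d (fromDigits ds)))
  (cong (d ∷_) (toDigits-fromDigits ds))

TwoStepFresh : ∀ {n k} → (Vec (Fin n) k → Fin n) → Set
TwoStepFresh {n} {k} g =
  (t : Vec (Fin n) k) →
    (g t ∉ toList t)
    × ((t₁ : Fin n) (rest : List (Fin n)) →
         toList t ↭ (t₁ ∷ rest) →
         (t' : Vec (Fin n) k) →
         toList t' ↭ (rest ++ [ g t ]) →
         g t' ∉ toList t)

module TwoStepFreshChoice {m k : ℕ} (room : k * suc k < m) where

  J : Set
  J = Fin (m ^ suc k)

  label : J → Fin m
  label = head ∘ toDigits (suc k)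

  footprint : Vec J k → Vec (Fin m) (k * suc k)
  footprint t = concat (map (toDigits (suc k)) t)

  ∈-footprint : ∀ {x d} {t : Vec J k} → x ∈ t → d ∈ toDigits (suc k) x → d ∈ footprint t
  ∈-footprint x∈t d∈x = concat⁺ (map⁺ (Any.map (λ { refl → d∈x }) x∈t))

  fresh : Vec J k → Fin m
  fresh t = proj₁ (n<m⇒∃∉ room (footprint t))

  fresh∉footprint : (t : Vec J k) → ¬ fresh t ∈ footprint t
  fresh∉footprint t = proj₂ (n<m⇒∃∉ room (footprint t))

  next : Vec J k → J
  next t = fromDigits (fresh t ∷ map label t)

  toDigits-next : (t : Vec J k) → toDigits (suc k) (next t) ≡ fresh t ∷ map label t
  toDigits-next t = toDigits-fromDigits (fresh t ∷ map label t)

  label-next : (t : Vec J k) → label (next t) ≡ fresh t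
  label-next t = cong head (toDigits-next t)

  next∉ : (t : Vec J k) → ¬ next t ∈ t
  next∉ t next∈t = fresh∉footprint t
    (subst (_∈ footprint t) (label-next t) (∈-footprint next∈t (Any.here refl)))

  next∉-after : (t t' : Vec J k) → next t ∈ t' → ¬ next t' ∈ t
  next∉-after t t' next∈t' next'∈t = fresh∉footprint t' (∈-footprint next∈t' fresh'∈next)
    where
    fresh'∈next : fresh t' ∈ toDigits (suc k) (next t)
    fresh'∈next = subst (fresh t' ∈_) (sym (toDigits-next t))
      (Any.there (subst (_∈ map label t) (label-next t') (∈-map⁺ label next'∈t)))

  next-twoStepFresh : TwoStepFresh next
  next-twoStepFresh t = next∉ t ∘ ∈-toList⁻ , λ _ rest _ t' t'↭ →
    next∉-after t t' (∈-toList⁻ (∈-resp-↭ (↭-sym t'↭) (∈-++⁺ʳ rest (here refl)))) ∘ ∈-toList⁻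

lemma3 : (k : ℕ) → 0 < k →
    Σ (Vec (Fin (size k)) k → Fin (size k)) λ g →
      (t : Vec (Fin (size k)) k) →
        (g t ∉ toList t)
        × ((t₁ : Fin (size k)) (rest : List (Fin (size k))) →
             toList t ↭ (t₁ ∷ rest) →
             (t' : Vec (Fin (size k)) k) →
             toList t' ↭ (rest ++ [ g t ]) →
             g t' ∉ toList t)
-- The construction needs no assumption on k; the hypothesis 0 < k is unused.
lemma3 k _ = subst (λ n → Σ (Vec (Fin n) k → Fin n) TwoStepFresh) (cong (m ^_) (+-comm 1 k))
                   (_ , TwoStepFreshChoice.next-twoStepFresh room)
  where
  m : ℕ
  m = k * k + k + 1

  room : k * suc k < m
  room = subst (_< m) (trans (+-comm (k * k) k) (sym (*-suc k k))) (m<m+n (k * k + k) z<s)
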